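{- Let $k \in \mathbb{N}$, $k \geq 1$. Then there exists a polynomial $$A_{k-1}(n;x) = a_{k-1}(n)\,x^{k-1} + a_{k-2}(n)\,x^{k-2} + \cdots + a_1(n)\,x + a_0(n)$$ in $x$, whose coefficients $a_j(n)$, $0 \le j \le k-1$, are polynomials in $n$ with integer coefficients, such that for every $N \in \mathbb{N}$ the identity $$\sum_{n=0}^{N-1} n!\,\bigl[\,n^k x^k + U_k(x)\,\bigr]\,x^n \;=\; V_k(x) + N!\,x^N A_{k-1}(N;x)$$ holds (as a polynomial identity in $x$, hence for $x$ in $\mathbb{R}$ and in every $\mathbb{Q}_p$), where $$U_k(x) = x\,A_{k-1}(1;x) - A_{k-1}(0;x), \qquad V_k(x) = -A_{k-1}(0;x).$$
   Context: $n! = 1\cdot 2\cdots n$ with $0! = 1$. $\mathbb{Q}_p$ denotes the field of $p$-adic numbers for a prime $p$. -}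

module Defs where

open import Data.Nat using (ℕ; zero; suc; _!)
open import Data.Integer using (ℤ; +_; _+_; _*_; -_; _^_)
open import Data.List using (List; []; _∷_)
open import Data.Vec using (Vec; []; _∷_)

-- A polynomial in one variable with integer coefficients, given by its
-- coefficient list [c₀, c₁, c₂, …] (lowest degree first).
IntPoly : Set
IntPoly = List ℤ

evalP : IntPoly → ℤ → ℤ
evalP []       t = + 0
evalP (c ∷ cs) t = c + t * evalP cs t

evalAFrom : ∀ {m} → ℕ → Vec IntPoly m → ℤ → ℤ → ℤ
evalAFrom j []       n x = + 0
evalAFrom j (a ∷ as) n x = evalP a n * x ^ j + evalAFrom (suc j) as n x

-- A polynomial in x of degree ≤ k-1 whose coefficients a_j(n) (0 ≤ j ≤ k-1)
-- are integer polynomials in n:  a = (a₀, a₁, …, a_{k-1}).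
-- evalA a n x = Σ_{j=0}^{k-1} a_j(n) x^j  =  A_{k-1}(n; x).
evalA : ∀ {k} → Vec IntPoly k → ℤ → ℤ → ℤ
evalA a n x = evalAFrom 0 a n x

sumBelow : ℕ → (ℕ → ℤ) → ℤ
sumBelow zero    f = + 0
sumBelow (suc N) f = sumBelow N f + f N

U : ∀ {k} → Vec IntPoly k → ℤ → ℤ
U a x = x * evalA a (+ 1) x + - evalA a (+ 0) x

V : ∀ {k} → Vec IntPoly k → ℤ → ℤ
V a x = - evalA a (+ 0) x

{-# OPTIONS --safe #-}
module Submission where

-- For the twisted difference  Δ A (m; x) = m x A(m; x) − A(m − 1; x)  we have
--   n! x^n Δ A (n + 1; x) = (n + 1)! x^(n+1) A(n + 1; x) − n! x^n A(n; x),
-- so the sum telescopes to  N! x^N A(N; x) − A(0; x)  whenever the summand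
-- equals n! x^n Δ A (n + 1; x).  It therefore suffices to find A with
-- Δ A (m; x) = x^k (m − 1)^k − c(x), c independent of m; evaluating at
-- m = 1 then gives U = −c.  Such an A exists for x^d q(m − 1), q any
-- polynomial of degree ≤ d, by induction on d: writing
-- q(m − 1) = h + m q′(m), the term q′(m) x^(d−1) added to A contributes
-- x^d m q′(m) − x^(d−1) q′(m − 1), and the second part is cancelled by the
-- solution for x^(d−1) q′(m − 1).

open import Defs
open import Data.Nat using (ℕ; zero; suc; _≤_; _!)
import Data.Nat as ℕ
import Data.Nat.Properties as ℕ
open import Data.Integer using (ℤ; +_; _+_; _-_; _*_; _^_; -_; 0ℤ; 1ℤ)
open import Data.Integer.Properties using (+-comm; +-identityˡ; *-comm; pos-*)
open import Data.Integer.Tactic.RingSolver using (solve-∀)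
open import Data.Vec using (Vec; []; _∷_; _∷ʳ_; head; tail; toList)
open import Data.Product using (∃; _,_)
open import Relation.Binary.PropositionalEquality
  using (_≡_; refl; cong; cong₂; sym; trans; module ≡-Reasoning)

open ≡-Reasoning

evalV : ∀ {n} → Vec ℤ n → ℤ → ℤ
evalV p = evalP (toList p)

evalV-head-tail : ∀ {n} (p : Vec ℤ (suc n)) t → evalV p t ≡ head p + t * evalV (tail p) t
evalV-head-tail (c ∷ p) t = refl

_+[X-_]*_ : ∀ {n} → ℤ → ℤ → Vec ℤ n → Vec ℤ (suc n)
c +[X- s ]* []      = c ∷ []
c +[X- s ]* (b ∷ p) = (c - s * b) ∷ (b +[X- s ]* p)

evalV-+[X-]* : ∀ {n} c s (p : Vec ℤ n) t →
  evalV (c +[X- s ]* p) t ≡ c + (t - s) * evalV p t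
evalV-+[X-]* c s []      t = rearrange c s t
  where
  rearrange : ∀ c s t → c + t * 0ℤ ≡ c + (t - s) * 0ℤ
  rearrange = solve-∀
evalV-+[X-]* c s (b ∷ p) t = begin
  c - s * b + t * evalV (b +[X- s ]* p) t
    ≡⟨ cong (λ e → c - s * b + t * e) (evalV-+[X-]* b s p t) ⟩
  c - s * b + t * (b + (t - s) * evalV p t)
    ≡⟨ rearrange c s b t (evalV p t) ⟩
  c + (t - s) * (b + t * evalV p t) ∎
  where
  rearrange : ∀ c s b t e → c - s * b + t * (b + (t - s) * e) ≡ c + (t - s) * (b + t * e)
  rearrange = solve-∀

translate : ∀ {n} → ℤ → Vec ℤ n → Vec ℤ n
translate s []      = []
translate s (c ∷ p) = c +[X- s ]* translate s p

evalV-translate : ∀ {n} s (p : Vec ℤ n) t → evalV (translate s p) t ≡ evalV p (t - s)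
evalV-translate s []      t = refl
evalV-translate s (c ∷ p) t = begin
  evalV (c +[X- s ]* translate s p) t   ≡⟨ evalV-+[X-]* c s (translate s p) t ⟩
  c + (t - s) * evalV (translate s p) t ≡⟨ cong (λ e → c + (t - s) * e) (evalV-translate s p t) ⟩
  c + (t - s) * evalV p (t - s)         ∎

monomial : (k : ℕ) → Vec ℤ (suc k)
monomial zero    = 1ℤ ∷ []
monomial (suc k) = 0ℤ ∷ monomial k

evalV-monomial : ∀ k t → evalV (monomial k) t ≡ t ^ k
evalV-monomial zero    t = rearrange t
  where
  rearrange : ∀ t → 1ℤ + t * 0ℤ ≡ 1ℤ
  rearrange = solve-∀
evalV-monomial (suc k) t = trans (+-identityˡ _) (cong (t *_) (evalV-monomial k t))

evalAFrom-∷ʳ : ∀ {l} j (a : Vec IntPoly l) b n x →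
  evalAFrom j (a ∷ʳ b) n x ≡ evalAFrom j a n x + evalP b n * x ^ (j ℕ.+ l)
evalAFrom-∷ʳ j [] b n x = begin
  evalP b n * x ^ j + 0ℤ           ≡⟨ +-comm (evalP b n * x ^ j) 0ℤ ⟩
  0ℤ + evalP b n * x ^ j           ≡⟨ cong (λ i → 0ℤ + evalP b n * x ^ i) (sym (ℕ.+-identityʳ j)) ⟩
  0ℤ + evalP b n * x ^ (j ℕ.+ 0)   ∎
evalAFrom-∷ʳ {suc l} j (c ∷ a) b n x = begin
  evalP c n * x ^ j + evalAFrom (suc j) (a ∷ʳ b) n x
    ≡⟨ cong (λ e → evalP c n * x ^ j + e) (evalAFrom-∷ʳ (suc j) a b n x) ⟩
  evalP c n * x ^ j + (evalAFrom (suc j) a n x + evalP b n * x ^ (suc j ℕ.+ l))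
    ≡⟨ rearrange (evalP c n * x ^ j) (evalAFrom (suc j) a n x) (evalP b n * x ^ (suc j ℕ.+ l)) ⟩
  evalP c n * x ^ j + evalAFrom (suc j) a n x + evalP b n * x ^ (suc j ℕ.+ l)
    ≡⟨ cong (λ i → evalP c n * x ^ j + evalAFrom (suc j) a n x + evalP b n * x ^ i) (sym (ℕ.+-suc j l)) ⟩
  evalP c n * x ^ j + evalAFrom (suc j) a n x + evalP b n * x ^ (j ℕ.+ suc l) ∎
  where
  rearrange : ∀ u v w → u + (v + w) ≡ u + v + w
  rearrange = solve-∀

twistedDiff : ∀ {l} → Vec IntPoly l → ℤ → ℤ → ℤ
twistedDiff a m x = m * x * evalA a m x - evalA a (m - 1ℤ) x

twistedDiff-∷ʳ : ∀ {l} (a : Vec IntPoly l) b m x →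
  twistedDiff (a ∷ʳ b) m x ≡ twistedDiff a m x + x ^ l * (m * x * evalP b m - evalP b (m - 1ℤ))
twistedDiff-∷ʳ {l} a b m x = begin
  m * x * evalA (a ∷ʳ b) m x - evalA (a ∷ʳ b) (m - 1ℤ) x
    ≡⟨ cong₂ (λ u v → m * x * u - v) (evalAFrom-∷ʳ 0 a b m x) (evalAFrom-∷ʳ 0 a b (m - 1ℤ) x) ⟩
  m * x * (evalA a m x + evalP b m * x ^ l) - (evalA a (m - 1ℤ) x + evalP b (m - 1ℤ) * x ^ l)
    ≡⟨ rearrange m x (evalA a m x) (evalA a (m - 1ℤ) x) (evalP b m) (evalP b (m - 1ℤ)) (x ^ l) ⟩
  twistedDiff a m x + x ^ l * (m * x * evalP b m - evalP b (m - 1ℤ)) ∎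
  where
  rearrange : ∀ m x A A′ B B′ y →
    m * x * (A + B * y) - (A′ + B′ * y) ≡ (m * x * A - A′) + y * (m * x * B - B′)
  rearrange = solve-∀

antidiff : (d : ℕ) → Vec ℤ (suc d) → Vec IntPoly d
antidiff zero    q = []
antidiff (suc d) q = antidiff d q′ ∷ʳ toList q′
  where q′ = tail (translate 1ℤ q)

antidiffConst : (d : ℕ) → Vec ℤ (suc d) → ℤ → ℤ
antidiffConst zero    q x = head q
antidiffConst (suc d) q x = antidiffConst d (tail (translate 1ℤ q)) x + x ^ suc d * head (translate 1ℤ q)

twistedDiff-antidiff : ∀ d q m x →
  twistedDiff (antidiff d q) m x ≡ x ^ d * evalV q (m - 1ℤ) - antidiffConst d q x
twistedDiff-antidiff zero (c ∷ []) m x = rearrange m x c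
  where
  rearrange : ∀ m x c → m * x * 0ℤ - 0ℤ ≡ 1ℤ * (c + (m - 1ℤ) * 0ℤ) - c
  rearrange = solve-∀
twistedDiff-antidiff (suc d) q m x = begin
  twistedDiff (antidiff d q′ ∷ʳ toList q′) m x
    ≡⟨ twistedDiff-∷ʳ (antidiff d q′) (toList q′) m x ⟩
  twistedDiff (antidiff d q′) m x + x ^ d * (m * x * evalV q′ m - evalV q′ (m - 1ℤ))
    ≡⟨ cong (λ e → e + x ^ d * (m * x * evalV q′ m - evalV q′ (m - 1ℤ))) (twistedDiff-antidiff d q′ m x) ⟩
  x ^ d * evalV q′ (m - 1ℤ) - K + x ^ d * (m * x * evalV q′ m - evalV q′ (m - 1ℤ))
    ≡⟨ rearrange m x (x ^ d) h (evalV q′ m) (evalV q′ (m - 1ℤ)) K ⟩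
  x ^ suc d * (h + m * evalV q′ m) - (K + x ^ suc d * h)
    ≡⟨ cong (λ e → x ^ suc d * e - (K + x ^ suc d * h)) translate-split ⟩
  x ^ suc d * evalV q (m - 1ℤ) - antidiffConst (suc d) q x ∎
  where
  q′ = tail (translate 1ℤ q)
  h  = head (translate 1ℤ q)
  K  = antidiffConst d q′ x
  translate-split : h + m * evalV q′ m ≡ evalV q (m - 1ℤ)
  translate-split = trans (sym (evalV-head-tail (translate 1ℤ q) m)) (evalV-translate 1ℤ q m)
  rearrange : ∀ m x y h E E′ K →
    y * E′ - K + y * (m * x * E - E′) ≡ x * y * (h + m * E) - (K + x * y * h)
  rearrange = solve-∀

sumBelow-cong : ∀ {f g} → (∀ n → f n ≡ g n) → ∀ N → sumBelow N f ≡ sumBelow N g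
sumBelow-cong f≗g zero    = refl
sumBelow-cong f≗g (suc N) = cong₂ _+_ (sumBelow-cong f≗g N) (f≗g N)

sumBelow-twistedDiff : ∀ {l} (a : Vec IntPoly l) N x →
  sumBelow N (λ n → + (n !) * twistedDiff a (+ suc n) x * x ^ n)
    ≡ V a x + + (N !) * x ^ N * evalA a (+ N) x
sumBelow-twistedDiff a zero    x = rearrange (evalA a 0ℤ x)
  where
  rearrange : ∀ A → 0ℤ ≡ - A + 1ℤ * 1ℤ * A
  rearrange = solve-∀
sumBelow-twistedDiff a (suc N) x = begin
  sumBelow N _ + + (N !) * twistedDiff a (+ suc N) x * x ^ N
    ≡⟨ cong (λ e → e + + (N !) * twistedDiff a (+ suc N) x * x ^ N) (sumBelow-twistedDiff a N x) ⟩
  V a x + + (N !) * x ^ N * evalA a (+ N) x + + (N !) * twistedDiff a (+ suc N) x * x ^ N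
    ≡⟨ rearrange (V a x) (+ (N !)) (x ^ N) (evalA a (+ N) x) (evalA a (+ suc N) x) (+ suc N) x ⟩
  V a x + + suc N * + (N !) * (x * x ^ N) * evalA a (+ suc N) x
    ≡⟨ cong (λ e → V a x + e * (x * x ^ N) * evalA a (+ suc N) x) (sym (pos-* (suc N) (N !))) ⟩
  V a x + + (suc N !) * x ^ suc N * evalA a (+ suc N) x ∎
  where
  rearrange : ∀ V F y A A′ s x →
    V + F * y * A + F * (s * x * A′ - A) * y ≡ V + s * F * (x * y) * A′
  rearrange = solve-∀

theorem1 : (k : ℕ) → 1 ≤ k →
    ∃ λ (a : Vec IntPoly k) →
      (N : ℕ) → (x : ℤ) →
        sumBelow N (λ n → + (n !) * ((+ n) ^ k * x ^ k + U a x) * x ^ n)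
          ≡ V a x + + (N !) * x ^ N * evalA a (+ N) x
theorem1 k@(suc d) _ = a , λ N x → trans (sumBelow-cong (summand x) N) (sumBelow-twistedDiff a N x)
  where
  a = antidiff k (monomial k)
  K = antidiffConst k (monomial k)
  twistedDiff-a : ∀ m x → twistedDiff a m x ≡ x ^ k * (m - 1ℤ) ^ k - K x
  twistedDiff-a m x = trans (twistedDiff-antidiff k (monomial k) m x)
    (cong (λ e → x ^ k * e - K x) (evalV-monomial k (m - 1ℤ)))
  U-a : ∀ x → U a x ≡ - K x
  U-a x = trans (rearrange x (evalA a 1ℤ x) (evalA a 0ℤ x)) (trans (twistedDiff-a 1ℤ x) (sym (rearrange′ (x ^ k) (K x))))
    where
    rearrange : ∀ x A A′ → x * A + - A′ ≡ 1ℤ * x * A - A′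
    rearrange = solve-∀
    rearrange′ : ∀ y K → - K ≡ y * 0ℤ - K
    rearrange′ = solve-∀
  summand : ∀ x n → + (n !) * ((+ n) ^ k * x ^ k + U a x) * x ^ n ≡ + (n !) * twistedDiff a (+ suc n) x * x ^ n
  summand x n = cong (λ e → + (n !) * e * x ^ n) (begin
    (+ n) ^ k * x ^ k + U a x   ≡⟨ cong₂ _+_ (*-comm ((+ n) ^ k) (x ^ k)) (U-a x) ⟩
    x ^ k * (+ n) ^ k - K x     ≡⟨ sym (twistedDiff-a (+ suc n) x) ⟩
    twistedDiff a (+ suc n) x   ∎)
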